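{- Let $(X,\mathcal S)$ be a $3$-sun system of order $n$. If $(X,\mathcal S)$ is embedded in a $3$-sun system of order $m>n$, then $m\geq \frac{7}{5}n+1$.
   Context: A $3$-sun is the graph on six vertices $a,b,c,d,e,f$ with edges $\{a,b\},\{b,c\},\{c,a\},\{a,d\},\{b,e\},\{c,f\}$. A $3$-sun system of order $n$ is a pair $(X,\mathcal S)$ with $|X|=n$ and $\mathcal S$ a collection of subgraphs of the complete graph on $X$, each isomorphic to a $3$-sun, whose edge sets partition the edge set of that complete graph. $(X_1,\mathcal S_1)$ is embedded in $(X_2,\mathcal S_2)$ if $X_1\subseteq X_2$ and $\mathcal S_1\subseteq \mathcal S_2$. -}

module Defs where

open import Data.Nat using (ℕ; _<_)
open import Data.Fin using (Fin; toℕ)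
open import Data.Fin.Properties using (_≟_)
open import Data.List using (List; []; _∷_; concatMap; map; length; filter)
open import Data.List.Membership.Propositional using (_∈_)
open import Data.Product using (_×_; _,_; Σ)
open import Data.Sum using (_⊎_)
open import Data.Vec using (Vec; _∷_; [])
open import Data.Vec.Relation.Unary.AllPairs using (AllPairs)
open import Relation.Binary.PropositionalEquality using (_≡_; _≢_)
open import Relation.Nullary using (Dec; yes; no)
open import Relation.Nullary.Decidable using (_×-dec_; _⊎-dec_)
open import Function using (_⇔_; Injective)

-- A (labelled) copy of a 3-sun in K_k: six pairwise distinct vertices
-- a b c d e f, with edges ab, bc, ca, ad, be, cf.
record Sun (k : ℕ) : Set where
  constructor sun
  field
    verts    : Vec (Fin k) 6
    distinct : AllPairs _≢_ verts

Edge : ℕ → Set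
Edge k = Fin k × Fin k

sunEdges : ∀ {k} → Sun k → List (Edge k)
sunEdges (sun (a ∷ b ∷ c ∷ d ∷ e ∷ f ∷ []) _) =
  (a , b) ∷ (b , c) ∷ (c , a) ∷ (a , d) ∷ (b , e) ∷ (c , f) ∷ []

SameEdge : ∀ {k} → Fin k → Fin k → Edge k → Set
SameEdge x y (u , v) = (u ≡ x × v ≡ y) ⊎ (u ≡ y × v ≡ x)

sameEdge? : ∀ {k} (x y : Fin k) (e : Edge k) → Dec (SameEdge x y e)
sameEdge? x y (u , v) = ((u ≟ x) ×-dec (v ≟ y)) ⊎-dec ((u ≟ y) ×-dec (v ≟ x))

edgeMultiplicity : ∀ {k} → List (Sun k) → Fin k → Fin k → ℕ
edgeMultiplicity S x y = length (filter (sameEdge? x y) (concatMap sunEdges S))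

-- (Fin k , S) is a 3-sun system of order k: the edge sets of the suns in S
-- partition the edge set of K_k, i.e. every edge {x,y} (x ≠ y) lies in
-- exactly one edge-slot of exactly one sun of S.
IsSunSystem : (k : ℕ) → List (Sun k) → Set
IsSunSystem k S = ∀ (x y : Fin k) → x ≢ y → edgeMultiplicity S x y ≡ 1

SameSubgraph : ∀ {k} → Sun k → Sun k → Set
SameSubgraph s t = ∀ x y →
  (Σ (Edge _) λ e → e ∈ sunEdges s × SameEdge x y e) ⇔
  (Σ (Edge _) λ e → e ∈ sunEdges t × SameEdge x y e)

mapSun : ∀ {n m} (ι : Fin n → Fin m) → Injective _≡_ _≡_ ι → Sun n → Sun m
mapSun ι inj (sun vs ds) = sun (Data.Vec.map ι vs) (go vs ds)
  where
  open import Data.Vec.Relation.Unary.All using (All; []; _∷_)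
  import Data.Vec.Relation.Unary.All as All
  go : ∀ {l} (ws : Vec _ l) → AllPairs _≢_ ws → AllPairs _≢_ (Data.Vec.map ι ws)
  go [] AllPairs.[] = AllPairs.[]
  go (w ∷ ws) (p AllPairs.∷ ps) = allmap ws p AllPairs.∷ go ws ps
    where
    allmap : ∀ {l} (us : Vec _ l) → All (w ≢_) us → All ((ι w) ≢_) (Data.Vec.map ι us)
    allmap [] [] = []
    allmap (u ∷ us) (q ∷ qs) = (λ eq → q (inj eq)) ∷ allmap us qs

EmbeddedIn : ∀ {n m} → List (Sun n) → List (Sun m) → Set
EmbeddedIn {n} {m} S₁ S₂ =
  Σ (Fin n → Fin m) λ ι → Σ (Injective _≡_ _≡_ ι) λ inj →
    ∀ s → s ∈ S₁ → Σ (Sun m) λ t → t ∈ S₂ × SameSubgraph (mapSun ι inj s) t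

-- Call the n vertices of the small system old and the u = m − n others new.
-- A sun of the big system with an edge between two old vertices is the image
-- of a sun of the small system, so all its vertices are old.  Every other sun
-- has no old–old edge; its triangle then has at most one old vertex, hence a
-- new–new edge, and at most 5 of its 6 edges are mixed.  The big system covers
-- each of the n·u mixed pairs and u(u − 1)/2 new–new pairs exactly once, so
-- n·u ≤ 5·u(u − 1)/2, i.e. 2n + 5 ≤ 5u, which is 7n + 5 ≤ 5m.

module Submission where

open import Defs
open import Data.Nat using (ℕ; zero; suc; _<_; _≤_; _*_; _+_; _∸_; z≤n; s≤s)
import Data.Nat.Properties as ℕ
open import Data.Nat.Properties hiding (_≟_; suc-injective; 0≢1+n)
open import Algebra.Properties.CommutativeSemigroup +-commutativeSemigroup using (interchange)
open import Data.Nat.ListAction using (sum)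
open import Data.Nat.ListAction.Properties using (sum-++)
open import Data.Nat.Tactic.RingSolver using (solve-∀)
open import Algebra.Properties.Semiring.Sum +-*-semiring
  using (sum-syntax; sum-cong-≗; sum-replicate-zero; ∑-distrib-+; ∑-comm; *-distribˡ-sum; *-distribʳ-sum)
open import Data.Fin using (Fin; zero; suc)
open import Data.Fin.Properties using (_≟_; suc-injective; 0≢1+n)
open import Data.Bool using (true; false; if_then_else_)
open import Data.List using (List; []; _∷_; _++_; concatMap; filter; length; map)
open import Data.List.Properties using (map-++; map-cong)
open import Data.List.Relation.Unary.Any using (here; there; any?)
open import Data.List.Relation.Unary.All using (All; []; _∷_; tabulate)
import Data.List.Relation.Unary.All as All
open import Data.List.Relation.Unary.All.Properties using (¬Any⇒All¬; ++⁺)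
open import Data.List.Membership.Propositional using (_∈_; find)
open import Data.List.Membership.Propositional.Properties using (∈-map⁺; ∈-map⁻)
open import Data.Vec using ([]; _∷_)
open import Data.Vec.Relation.Unary.AllPairs using (_∷_)
import Data.Vec.Relation.Unary.All as Vec
open import Data.Product using (Σ; ∃; _×_; _,_; proj₁; proj₂)
import Data.Product as Product
open import Data.Sum using (_⊎_; inj₁; inj₂; [_,_])
import Data.Sum as Sum
open import Data.Empty using (⊥-elim)
open import Relation.Nullary using (Dec; yes; no; does; ¬_)
open import Relation.Nullary.Decidable using (dec-true; dec-false; _×-dec_; _⊎-dec_)
open import Relation.Unary using (Decidable)
open import Relation.Binary.PropositionalEquality hiding ([_])
open import Function using (_∘_; Injective; Equivalence)

private
  variable
    k : ℕ
    A B : Set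

𝟙 : Dec A → ℕ
𝟙 a? = if does a? then 1 else 0

𝟙-yes : (a? : Dec A) → A → 𝟙 a? ≡ 1
𝟙-yes a? a rewrite dec-true a? a = refl

𝟙-no : (a? : Dec A) → ¬ A → 𝟙 a? ≡ 0
𝟙-no a? ¬a rewrite dec-false a? ¬a = refl

𝟙-pos : (a? : Dec A) → 1 ≤ 𝟙 a? → A
𝟙-pos (yes a) _ = a

𝟙-×-dec : (a? : Dec A) (b? : Dec B) → 𝟙 (a? ×-dec b?) ≡ 𝟙 a? * 𝟙 b?
𝟙-×-dec (yes _) (yes _) = refl
𝟙-×-dec (yes _) (no _) = refl
𝟙-×-dec (no _) _ = refl

𝟙-⊎-dec : (a? : Dec A) (b? : Dec B) → ¬ (A × B) → 𝟙 (a? ⊎-dec b?) ≡ 𝟙 a? + 𝟙 b?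
𝟙-⊎-dec (yes a) (yes b) ¬ab = ⊥-elim (¬ab (a , b))
𝟙-⊎-dec (yes _) (no _) _ = refl
𝟙-⊎-dec (no _) _ _ = refl

length-filter≡sum-𝟙 : {P : A → Set} (P? : Decidable P) (xs : List A) →
  length (filter P? xs) ≡ sum (map (𝟙 ∘ P?) xs)
length-filter≡sum-𝟙 P? [] = refl
length-filter≡sum-𝟙 P? (x ∷ xs) with does (P? x)
... | true  = cong suc (length-filter≡sum-𝟙 P? xs)
... | false = length-filter≡sum-𝟙 P? xs

sum-map-++ : (f : A → ℕ) (xs ys : List A) →
  sum (map f (xs ++ ys)) ≡ sum (map f xs) + sum (map f ys)
sum-map-++ f xs ys = trans (cong sum (map-++ f xs ys)) (sum-++ (map f xs) (map f ys))

sum-map-concatMap : (f : B → ℕ) (g : A → List B) (xs : List A) →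
  sum (map f (concatMap g xs)) ≡ sum (map (λ x → sum (map f (g x))) xs)
sum-map-concatMap f g [] = refl
sum-map-concatMap f g (x ∷ xs) =
  trans (sum-map-++ f (g x) (concatMap g xs)) (cong (sum (map f (g x)) +_) (sum-map-concatMap f g xs))

sum-map-+ : (f g : A → ℕ) (xs : List A) →
  sum (map (λ x → f x + g x) xs) ≡ sum (map f xs) + sum (map g xs)
sum-map-+ f g [] = refl
sum-map-+ f g (x ∷ xs) =
  trans (cong (f x + g x +_) (sum-map-+ f g xs)) (interchange (f x) (g x) _ _)

sum-map-zero : (f : A → ℕ) {xs : List A} → All (λ x → f x ≡ 0) xs → sum (map f xs) ≡ 0
sum-map-zero f [] = refl
sum-map-zero f (fx≡0 ∷ rest) = cong₂ _+_ fx≡0 (sum-map-zero f rest)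

∈⇒≤sum-map : (f : A → ℕ) {x : A} {xs : List A} → x ∈ xs → f x ≤ sum (map f xs)
∈⇒≤sum-map f (here refl) = m≤m+n _ _
∈⇒≤sum-map f {xs = y ∷ _} (there x∈) = ≤-trans (∈⇒≤sum-map f x∈) (m≤n+m _ (f y))

sum-map-pos : (f : A → ℕ) (xs : List A) → 1 ≤ sum (map f xs) → ∃ λ x → x ∈ xs × 1 ≤ f x
sum-map-pos f (x ∷ xs) pos with f x in fx
... | suc _ = x , here refl , subst (1 ≤_) (sym fx) (s≤s z≤n)
... | zero  = let y , y∈ , fy = sum-map-pos f xs pos in y , there y∈ , fy

sum-map≡1⇒unique : (f : A → ℕ) {x y : A} {xs : List A} → sum (map f xs) ≡ 1 →
  x ∈ xs → y ∈ xs → 1 ≤ f x → 1 ≤ f y → x ≡ y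
sum-map≡1⇒unique f eq (here refl) (here refl) _ _ = refl
sum-map≡1⇒unique f eq (here refl) (there y∈) fx fy =
  ⊥-elim (<-irrefl (sym eq) (+-mono-≤ fx (≤-trans fy (∈⇒≤sum-map f y∈))))
sum-map≡1⇒unique f eq (there x∈) (here refl) fx fy =
  ⊥-elim (<-irrefl (sym eq) (+-mono-≤ fy (≤-trans fx (∈⇒≤sum-map f x∈))))
sum-map≡1⇒unique f {xs = z ∷ _} eq (there x∈) (there y∈) fx fy =
  sum-map≡1⇒unique f (≤-antisym (m+n≤o⇒n≤o (f z) (≤-reflexive eq)) (≤-trans fx (∈⇒≤sum-map f x∈)))
    x∈ y∈ fx fy

sum-map-complement : (f g : A → ℕ) {xs : List A} → All (λ x → f x + g x ≡ 1) xs →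
  sum (map f xs) + sum (map g xs) ≡ length xs
sum-map-complement f g [] = refl
sum-map-complement f g {x ∷ xs} (fx+gx≡1 ∷ rest) =
  trans (interchange (f x) _ (g x) _) (cong₂ _+_ fx+gx≡1 (sum-map-complement f g rest))

sum-map-scaled-≤ : (a b : ℕ) (f g : A → ℕ) {xs : List A} → All (λ x → a * f x ≤ b * g x) xs →
  a * sum (map f xs) ≤ b * sum (map g xs)
sum-map-scaled-≤ a b f g [] = ≤-reflexive (trans (*-zeroʳ a) (sym (*-zeroʳ b)))
sum-map-scaled-≤ a b f g {x ∷ xs} (le ∷ rest) = begin
  a * (f x + sum (map f xs))        ≡⟨ *-distribˡ-+ a (f x) _ ⟩
  a * f x + a * sum (map f xs)      ≤⟨ +-mono-≤ le (sum-map-scaled-≤ a b f g rest) ⟩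
  b * g x + b * sum (map g xs)      ≡⟨ *-distribˡ-+ b (g x) _ ⟨
  b * (g x + sum (map g xs))        ∎
  where open ≤-Reasoning

δ : Fin k → Fin k → ℕ
δ x y = 𝟙 (x ≟ y)

∑-zero : {f : Fin k → ℕ} → (∀ x → f x ≡ 0) → ∑[ x < k ] f x ≡ 0
∑-zero {k} f≡0 = trans (sum-cong-≗ {k} f≡0) (sum-replicate-zero k)

∑-const-1 : ∑[ x < k ] 1 ≡ k
∑-const-1 {zero} = refl
∑-const-1 {suc k} = cong suc (∑-const-1 {k})

≤-∑ : (f : Fin k → ℕ) (i : Fin k) → f i ≤ ∑[ x < k ] f x
≤-∑ f zero = m≤m+n _ _
≤-∑ f (suc i) = ≤-trans (≤-∑ (f ∘ suc) i) (m≤n+m _ (f zero))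

∑-pos : (f : Fin k → ℕ) → 1 ≤ ∑[ x < k ] f x → ∃ λ i → 1 ≤ f i
∑-pos {suc k} f pos with f zero in f0
... | suc _ = zero , subst (1 ≤_) (sym f0) (s≤s z≤n)
... | zero  = let i , fi = ∑-pos (f ∘ suc) pos in suc i , fi

∑-δ : (h : Fin k → ℕ) (v : Fin k) → ∑[ y < k ] (δ v y * h y) ≡ h v
∑-δ {suc k} h zero = trans (cong₂ _+_ (+-identityʳ (h zero)) (sum-replicate-zero k)) (+-identityʳ _)
∑-δ {suc k} h (suc v) = ∑-δ (h ∘ suc) v

∑∑-distrib-+ : (F G : Fin k → Fin k → ℕ) →
  ∑[ x < k ] ∑[ y < k ] (F x y + G x y) ≡ ∑[ x < k ] ∑[ y < k ] F x y + ∑[ x < k ] ∑[ y < k ] G x y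
∑∑-distrib-+ {k} F G =
  trans (sum-cong-≗ {k} (λ x → ∑-distrib-+ (F x) (G x))) (∑-distrib-+ (λ x → ∑[ y < k ] F x y) _)

∑∑-δ : (F : Fin k → Fin k → ℕ) (u v : Fin k) →
  ∑[ x < k ] ∑[ y < k ] (δ u x * δ v y * F x y) ≡ F u v
∑∑-δ {k} F u v = begin
  ∑[ x < k ] ∑[ y < k ] (δ u x * δ v y * F x y)
    ≡⟨ sum-cong-≗ {k} (λ x → sum-cong-≗ {k} (λ y → *-assoc (δ u x) (δ v y) (F x y))) ⟩
  ∑[ x < k ] ∑[ y < k ] (δ u x * (δ v y * F x y))
    ≡⟨ sum-cong-≗ {k} (λ x → sym (*-distribˡ-sum (δ u x) (λ y → δ v y * F x y))) ⟩
  ∑[ x < k ] (δ u x * ∑[ y < k ] (δ v y * F x y))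
    ≡⟨ sum-cong-≗ {k} (λ x → cong (δ u x *_) (∑-δ (F x) v)) ⟩
  ∑[ x < k ] (δ u x * F x v)
    ≡⟨ ∑-δ (λ x → F x v) u ⟩
  F u v ∎
  where open ≡-Reasoning

∑∑-* : (f g : Fin k → ℕ) → ∑[ x < k ] ∑[ y < k ] (f x * g y) ≡ ∑[ x < k ] f x * ∑[ y < k ] g y
∑∑-* {k} f g = begin
  ∑[ x < k ] ∑[ y < k ] (f x * g y)   ≡⟨ sum-cong-≗ {k} (λ x → sym (*-distribˡ-sum (f x) g)) ⟩
  ∑[ x < k ] (f x * ∑[ y < k ] g y)  ≡⟨ sym (*-distribʳ-sum (∑[ y < k ] g y) f) ⟩
  ∑[ x < k ] f x * ∑[ y < k ] g y    ∎
  where open ≡-Reasoning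

∑-δ-injective≤1 : {n : ℕ} (ι : Fin n → Fin k) → Injective _≡_ _≡_ ι → ∀ x → ∑[ i < n ] δ (ι i) x ≤ 1
∑-δ-injective≤1 {n = zero} ι ι-injective x = z≤n
∑-δ-injective≤1 {n = suc n} ι ι-injective x with ι zero ≟ x
... | yes ι0≡x = s≤s (≤-reflexive (∑-zero λ i →
      𝟙-no (ι (suc i) ≟ x) λ ιi≡x → 0≢1+n (ι-injective (trans ι0≡x (sym ιi≡x)))))
... | no _ = ∑-δ-injective≤1 (ι ∘ suc) (suc-injective ∘ ι-injective) x

occurs : Fin k → Fin k → Edge k → ℕ
occurs x y e = 𝟙 (sameEdge? x y e)

occurs-≢ : {x y u v : Fin k} → u ≢ v → occurs x y (u , v) ≡ δ u x * δ v y + δ u y * δ v x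
occurs-≢ {x = x} {y} {u} {v} u≢v =
  trans (𝟙-⊎-dec ((u ≟ x) ×-dec (v ≟ y)) ((u ≟ y) ×-dec (v ≟ x))
                 (λ ((u≡x , _) , (_ , v≡x)) → u≢v (trans u≡x (sym v≡x))))
        (cong₂ _+_ (𝟙-×-dec (u ≟ x) (v ≟ y)) (𝟙-×-dec (u ≟ y) (v ≟ x)))

occurs-loop : {x u v : Fin k} → u ≢ v → occurs x x (u , v) ≡ 0
occurs-loop {x = x} {u} {v} u≢v = 𝟙-no (sameEdge? x x (u , v)) [ joins , joins ]
  where
  joins : ¬ (u ≡ x × v ≡ x)
  joins (u≡x , v≡x) = u≢v (trans u≡x (sym v≡x))

Loopless : List (Edge k) → Set
Loopless = All λ e → proj₁ e ≢ proj₂ e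

CoversOnce : List (Edge k) → Set
CoversOnce {k} L = ∀ (x y : Fin k) → x ≢ y → sum (map (occurs x y) L) ≡ 1

sum-occurs-loop : {L : List (Edge k)} → Loopless L → ∀ x → sum (map (occurs x x) L) ≡ 0
sum-occurs-loop [] x = refl
sum-occurs-loop (u≢v ∷ loopless) x = cong₂ _+_ (occurs-loop u≢v) (sum-occurs-loop loopless x)

sum-occurs+δ : {L : List (Edge k)} → Loopless L → CoversOnce L →
  ∀ x y → sum (map (occurs x y) L) + δ x y ≡ 1
sum-occurs+δ loopless covers x y with x ≟ y
... | yes refl = cong (_+ 1) (sum-occurs-loop loopless x)
... | no x≢y   = trans (+-identityʳ _) (covers x y x≢y)

edgeWeight : (f g : Fin k → ℕ) → Edge k → ℕ
edgeWeight f g (u , v) = f u * g v + f v * g u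

∑∑-occurs : (f g : Fin k → ℕ) {u v : Fin k} → u ≢ v →
  ∑[ x < k ] ∑[ y < k ] (f x * g y * occurs x y (u , v)) ≡ edgeWeight f g (u , v)
∑∑-occurs {k} f g {u} {v} u≢v = begin
  ∑[ x < k ] ∑[ y < k ] (f x * g y * occurs x y (u , v))
    ≡⟨ sum-cong-≗ {k} (λ x → sum-cong-≗ {k} (λ y →
         trans (cong (f x * g y *_) (occurs-≢ u≢v)) (regroup (f x) (g y) (δ u x) (δ v y) (δ u y) (δ v x)))) ⟩
  ∑[ x < k ] ∑[ y < k ] (δ u x * δ v y * (f x * g y) + δ v x * δ u y * (f x * g y))
    ≡⟨ ∑∑-distrib-+ (λ x y → δ u x * δ v y * (f x * g y)) (λ x y → δ v x * δ u y * (f x * g y)) ⟩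
  ∑[ x < k ] ∑[ y < k ] (δ u x * δ v y * (f x * g y)) + ∑[ x < k ] ∑[ y < k ] (δ v x * δ u y * (f x * g y))
    ≡⟨ cong₂ _+_ (∑∑-δ (λ x y → f x * g y) u v) (∑∑-δ (λ x y → f x * g y) v u) ⟩
  edgeWeight f g (u , v) ∎
  where
  open ≡-Reasoning
  regroup : ∀ a b c d e f → a * b * (c * d + e * f) ≡ c * d * (a * b) + f * e * (a * b)
  regroup = solve-∀

∑∑-sum-occurs : (f g : Fin k → ℕ) {L : List (Edge k)} → Loopless L →
  ∑[ x < k ] ∑[ y < k ] (f x * g y * sum (map (occurs x y) L)) ≡ sum (map (edgeWeight f g) L)
∑∑-sum-occurs {k} f g [] =
  ∑-zero (λ x → ∑-zero (λ y → *-zeroʳ (f x * g y)))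
∑∑-sum-occurs {k} f g {e ∷ L} (u≢v ∷ loopless) = begin
  ∑[ x < k ] ∑[ y < k ] (f x * g y * (occurs x y e + sum (map (occurs x y) L)))
    ≡⟨ sum-cong-≗ {k} (λ x → sum-cong-≗ {k} (λ y → *-distribˡ-+ (f x * g y) _ _)) ⟩
  ∑[ x < k ] ∑[ y < k ] (f x * g y * occurs x y e + f x * g y * sum (map (occurs x y) L))
    ≡⟨ ∑∑-distrib-+ (λ x y → f x * g y * occurs x y e) (λ x y → f x * g y * sum (map (occurs x y) L)) ⟩
  ∑[ x < k ] ∑[ y < k ] (f x * g y * occurs x y e) + ∑[ x < k ] ∑[ y < k ] (f x * g y * sum (map (occurs x y) L))
    ≡⟨ cong₂ _+_ (∑∑-occurs f g u≢v) (∑∑-sum-occurs f g loopless) ⟩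
  edgeWeight f g e + sum (map (edgeWeight f g) L) ∎
  where open ≡-Reasoning

-- Each pair x ≠ y is an edge of L once and each x is on the diagonal once, so the
-- edge weights supply exactly the off-diagonal terms of (∑ f) (∑ g).
sum-edgeWeight : (f g : Fin k → ℕ) {L : List (Edge k)} → Loopless L → CoversOnce L →
  sum (map (edgeWeight f g) L) + ∑[ x < k ] (f x * g x) ≡ ∑[ x < k ] f x * ∑[ y < k ] g y
sum-edgeWeight {k} f g {L} loopless covers = begin
  sum (map (edgeWeight f g) L) + ∑[ x < k ] (f x * g x)
    ≡⟨ cong₂ _+_ (sym (∑∑-sum-occurs f g loopless))
                 (sum-cong-≗ {k} (λ x → sym (trans (sum-cong-≗ {k} (λ y → *-comm (f x * g y) (δ x y)))
                                                   (∑-δ (λ y → f x * g y) x)))) ⟩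
  ∑[ x < k ] ∑[ y < k ] (f x * g y * sum (map (occurs x y) L)) + ∑[ x < k ] ∑[ y < k ] (f x * g y * δ x y)
    ≡⟨ sym (∑∑-distrib-+ (λ x y → f x * g y * sum (map (occurs x y) L)) (λ x y → f x * g y * δ x y)) ⟩
  ∑[ x < k ] ∑[ y < k ] (f x * g y * sum (map (occurs x y) L) + f x * g y * δ x y)
    ≡⟨ sum-cong-≗ {k} (λ x → sum-cong-≗ {k} (λ y → begin
         f x * g y * sum (map (occurs x y) L) + f x * g y * δ x y
           ≡⟨ *-distribˡ-+ (f x * g y) _ _ ⟨
         f x * g y * (sum (map (occurs x y) L) + δ x y)
           ≡⟨ cong (f x * g y *_) (sum-occurs+δ loopless covers x y) ⟩
         f x * g y * 1
           ≡⟨ *-identityʳ _ ⟩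
         f x * g y ∎)) ⟩
  ∑[ x < k ] ∑[ y < k ] (f x * g y)
    ≡⟨ ∑∑-* f g ⟩
  ∑[ x < k ] f x * ∑[ y < k ] g y ∎
  where open ≡-Reasoning

sunEdges-loopless : (t : Sun k) → Loopless (sunEdges t)
sunEdges-loopless (sun (a ∷ b ∷ c ∷ d ∷ e ∷ f ∷ [])
  ((a≢b Vec.∷ a≢c Vec.∷ a≢d Vec.∷ _) ∷ (b≢c Vec.∷ _ Vec.∷ b≢e Vec.∷ _) ∷ (_ Vec.∷ _ Vec.∷ c≢f Vec.∷ _) ∷ _)) =
  a≢b ∷ b≢c ∷ (a≢c ∘ sym) ∷ a≢d ∷ b≢e ∷ c≢f ∷ []

sunSystem-loopless : (S : List (Sun k)) → Loopless (concatMap sunEdges S)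
sunSystem-loopless [] = []
sunSystem-loopless (t ∷ S) = ++⁺ (sunEdges-loopless t) (sunSystem-loopless S)

sunSystem-coversOnce : (S : List (Sun k)) → IsSunSystem k S → CoversOnce (concatMap sunEdges S)
sunSystem-coversOnce S system x y x≢y =
  trans (sym (length-filter≡sum-𝟙 (sameEdge? x y) (concatMap sunEdges S))) (system x y x≢y)

HasEdge : Sun k → Fin k → Fin k → Set
HasEdge t x y = Σ (Edge _) λ e → e ∈ sunEdges t × SameEdge x y e

HasEdge⇒occurs : {t : Sun k} {x y : Fin k} → HasEdge t x y → 1 ≤ sum (map (occurs x y) (sunEdges t))
HasEdge⇒occurs {x = x} {y} (e , e∈ , same) =
  ≤-trans (≤-reflexive (sym (𝟙-yes (sameEdge? x y e) same))) (∈⇒≤sum-map (occurs x y) e∈)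

occurs⇒HasEdge : (t : Sun k) {x y : Fin k} → 1 ≤ sum (map (occurs x y) (sunEdges t)) → HasEdge t x y
occurs⇒HasEdge t {x} {y} pos =
  let e , e∈ , occ = sum-map-pos (occurs x y) (sunEdges t) pos in e , e∈ , 𝟙-pos (sameEdge? x y e) occ

edgeMultiplicity≡sum : (S : List (Sun k)) (x y : Fin k) →
  edgeMultiplicity S x y ≡ sum (map (λ t → sum (map (occurs x y) (sunEdges t))) S)
edgeMultiplicity≡sum S x y =
  trans (length-filter≡sum-𝟙 (sameEdge? x y) (concatMap sunEdges S)) (sum-map-concatMap (occurs x y) sunEdges S)

sunSystem-covers : {S : List (Sun k)} → IsSunSystem k S → {x y : Fin k} → x ≢ y →
  ∃ λ t → t ∈ S × HasEdge t x y
sunSystem-covers {S = S} system {x} {y} x≢y =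
  let t , t∈ , pos = sum-map-pos _ S (≤-reflexive (trans (sym (system x y x≢y)) (edgeMultiplicity≡sum S x y)))
  in t , t∈ , occurs⇒HasEdge t pos

sunSystem-unique : {S : List (Sun k)} → IsSunSystem k S → {x y : Fin k} → x ≢ y →
  {t t′ : Sun k} → t ∈ S → t′ ∈ S → HasEdge t x y → HasEdge t′ x y → t ≡ t′
sunSystem-unique {S = S} system {x} {y} x≢y t∈ t′∈ t∋xy t′∋xy =
  sum-map≡1⇒unique _ (trans (sym (edgeMultiplicity≡sum S x y)) (system x y x≢y))
    t∈ t′∈ (HasEdge⇒occurs t∋xy) (HasEdge⇒occurs t′∋xy)

module ImageIndicator {n m : ℕ} (ι : Fin n → Fin m) (ι-injective : Injective _≡_ _≡_ ι) where

  χ : Fin m → ℕ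
  χ x = ∑[ i < n ] δ (ι i) x

  χ≤1 : ∀ x → χ x ≤ 1
  χ≤1 = ∑-δ-injective≤1 ι ι-injective

  χ-image : ∀ i → χ (ι i) ≡ 1
  χ-image i = ≤-antisym (χ≤1 (ι i))
    (subst (_≤ χ (ι i)) (𝟙-yes (ι i ≟ ι i) refl) (≤-∑ (λ j → δ (ι j) (ι i)) i))

  χ-pos : ∀ {x} → 1 ≤ χ x → ∃ λ i → ι i ≡ x
  χ-pos {x} pos = let i , δ-pos = ∑-pos (λ j → δ (ι j) x) pos in i , 𝟙-pos (ι i ≟ x) δ-pos

  ∑-χ : ∑[ x < m ] χ x ≡ n
  ∑-χ = begin
    ∑[ x < m ] ∑[ i < n ] δ (ι i) x  ≡⟨ ∑-comm (λ x i → δ (ι i) x) ⟩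
    ∑[ i < n ] ∑[ x < m ] δ (ι i) x  ≡⟨ sum-cong-≗ {n} (λ i → ∑-δ-1 (ι i)) ⟩
    ∑[ i < n ] 1                     ≡⟨ ∑-const-1 ⟩
    n                                ∎
    where
    open ≡-Reasoning
    ∑-δ-1 : ∀ v → ∑[ x < m ] δ v x ≡ 1
    ∑-δ-1 v = trans (sum-cong-≗ {m} (λ x → sym (*-identityʳ (δ v x)))) (∑-δ (λ _ → 1) v)

mixed+new≡1 : ∀ {p q} → p ≤ 1 → q ≤ 1 → ¬ (p ≡ 1 × q ≡ 1) →
  p * (1 ∸ q) + q * (1 ∸ p) + (1 ∸ p) * (1 ∸ q) ≡ 1
mixed+new≡1 {0} {0} _ _ _ = refl
mixed+new≡1 {0} {1} _ _ _ = refl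
mixed+new≡1 {1} {0} _ _ _ = refl
mixed+new≡1 {1} {1} _ _ ¬old = ⊥-elim (¬old (refl , refl))
mixed+new≡1 {suc (suc _)} (s≤s ()) _ _
mixed+new≡1 {_} {suc (suc _)} _ (s≤s ()) _

triangle-new-edge : ∀ {p q r} w → p ≤ 1 → q ≤ 1 → r ≤ 1 →
  ¬ (p ≡ 1 × q ≡ 1) → ¬ (q ≡ 1 × r ≡ 1) → ¬ (r ≡ 1 × p ≡ 1) →
  1 ≤ (1 ∸ p) * (1 ∸ q) + ((1 ∸ q) * (1 ∸ r) + ((1 ∸ r) * (1 ∸ p) + w))
triangle-new-edge {0} {0} w _ _ _ _ _ _ = s≤s z≤n
triangle-new-edge {0} {1} {0} w _ _ _ _ _ _ = s≤s z≤n
triangle-new-edge {1} {0} {0} w _ _ _ _ _ _ = s≤s z≤n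
triangle-new-edge {1} {1} w _ _ _ ¬pq _ _ = ⊥-elim (¬pq (refl , refl))
triangle-new-edge {0} {1} {1} w _ _ _ _ ¬qr _ = ⊥-elim (¬qr (refl , refl))
triangle-new-edge {1} {0} {1} w _ _ _ _ _ ¬rp = ⊥-elim (¬rp (refl , refl))
triangle-new-edge {suc (suc _)} w (s≤s ()) _ _ _ _ _
triangle-new-edge {_} {suc (suc _)} w _ (s≤s ()) _ _ _ _
triangle-new-edge {_} {_} {suc (suc _)} w _ _ (s≤s ()) _ _ _

p*[1∸p]≡0 : ∀ {p} → p ≤ 1 → p * (1 ∸ p) ≡ 0
p*[1∸p]≡0 {0} _ = refl
p*[1∸p]≡0 {1} _ = refl
p*[1∸p]≡0 {suc (suc _)} (s≤s ())

[1∸p]*[1∸p]≡1∸p : ∀ {p} → p ≤ 1 → (1 ∸ p) * (1 ∸ p) ≡ 1 ∸ p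
[1∸p]*[1∸p]≡1∸p {0} _ = refl
[1∸p]*[1∸p]≡1∸p {1} _ = refl
[1∸p]*[1∸p]≡1∸p {suc (suc _)} (s≤s ())

m+n≡6⇒2m≤5[n+n] : ∀ {m n} → m + n ≡ 6 → 1 ≤ n → 2 * m ≤ 5 * (n + n)
m+n≡6⇒2m≤5[n+n] {m} {n} m+n≡6 1≤n = begin
  2 * m        ≤⟨ *-monoʳ-≤ 2 m≤5 ⟩
  2 * 5        ≤⟨ *-monoʳ-≤ 5 (+-mono-≤ 1≤n 1≤n) ⟩
  5 * (n + n)  ∎
  where
  open ≤-Reasoning
  m≤5 : m ≤ 5
  m≤5 = ≤-pred (subst (_≤ 6) (+-comm m 1) (subst (m + 1 ≤_) m+n≡6 (+-monoʳ-≤ m 1≤n)))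

-- χ marks the old vertices with 1 and ν the new ones; edgeWeight χ ν counts an
-- edge iff it is mixed, and edgeWeight ν ν counts a new–new edge twice.
module OldNewLabelling {k : ℕ} (χ : Fin k → ℕ) (χ≤1 : ∀ x → χ x ≤ 1) where

  ν : Fin k → ℕ
  ν x = 1 ∸ χ x

  BothOld : Edge k → Set
  BothOld e = χ (proj₁ e) ≡ 1 × χ (proj₂ e) ≡ 1

  bothOld? : Decidable BothOld
  bothOld? e = (χ (proj₁ e) ℕ.≟ 1) ×-dec (χ (proj₂ e) ℕ.≟ 1)

  bothNew : Edge k → ℕ
  bothNew e = ν (proj₁ e) * ν (proj₂ e)

  mixed-bothOld : ∀ e → BothOld e → edgeWeight χ ν e ≡ 0
  mixed-bothOld e (χu≡1 , χv≡1) rewrite χu≡1 | χv≡1 = refl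

  edgeWeight-νν : ∀ e → edgeWeight ν ν e ≡ bothNew e + bothNew e
  edgeWeight-νν (u , v) = cong (ν u * ν v +_) (*-comm (ν v) (ν u))

  -- A sun without old–old edges has a new–new edge in its triangle; it has
  -- six edges, all mixed or new–new, so at most five are mixed.
  sun-bound : (t : Sun k) → All BothOld (sunEdges t) ⊎ All (¬_ ∘ BothOld) (sunEdges t) →
    2 * sum (map (edgeWeight χ ν) (sunEdges t)) ≤ 5 * sum (map (edgeWeight ν ν) (sunEdges t))
  sun-bound t (inj₁ allOld) = begin
    2 * sum (map (edgeWeight χ ν) (sunEdges t))
      ≡⟨ cong (2 *_) (sum-map-zero (edgeWeight χ ν) (All.map (mixed-bothOld _) allOld)) ⟩
    0 ≤⟨ z≤n ⟩
    5 * sum (map (edgeWeight ν ν) (sunEdges t)) ∎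
    where open ≤-Reasoning
  sun-bound t@(sun (a ∷ b ∷ c ∷ d ∷ e ∷ f ∷ []) _) (inj₂ noOld@(¬ab ∷ ¬bc ∷ ¬ca ∷ _)) = begin
    2 * mixed        ≤⟨ m+n≡6⇒2m≤5[n+n] {mixed} {new} mixed+new≡6
                          (triangle-new-edge _ (χ≤1 a) (χ≤1 b) (χ≤1 c) ¬ab ¬bc ¬ca) ⟩
    5 * (new + new)  ≡⟨ cong (5 *_) (sum-map-+ bothNew bothNew (sunEdges t)) ⟨
    5 * sum (map (λ uv → bothNew uv + bothNew uv) (sunEdges t))
                     ≡⟨ cong (λ ws → 5 * sum ws) (map-cong edgeWeight-νν (sunEdges t)) ⟨
    5 * sum (map (edgeWeight ν ν) (sunEdges t)) ∎
    where
    open ≤-Reasoning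
    mixed new : ℕ
    mixed = sum (map (edgeWeight χ ν) (sunEdges t))
    new = sum (map bothNew (sunEdges t))
    mixed+new≡6 : mixed + new ≡ 6
    mixed+new≡6 = sum-map-complement (edgeWeight χ ν) bothNew
      (All.map (λ {uv} → mixed+new≡1 (χ≤1 (proj₁ uv)) (χ≤1 (proj₂ uv))) noOld)

  module _ {L : List (Edge k)} (loopless : Loopless L) (covers : CoversOnce L) where

    sum-edgeWeight-χν : sum (map (edgeWeight χ ν) L) ≡ ∑[ x < k ] χ x * ∑[ x < k ] ν x
    sum-edgeWeight-χν = begin
      sum (map (edgeWeight χ ν) L)                            ≡⟨ +-identityʳ _ ⟨
      sum (map (edgeWeight χ ν) L) + 0                        ≡⟨ cong (sum (map (edgeWeight χ ν) L) +_)
                                                                       (∑-zero (λ x → p*[1∸p]≡0 (χ≤1 x))) ⟨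
      sum (map (edgeWeight χ ν) L) + ∑[ x < k ] (χ x * ν x)  ≡⟨ sum-edgeWeight χ ν loopless covers ⟩
      ∑[ x < k ] χ x * ∑[ x < k ] ν x                         ∎
      where open ≡-Reasoning

    sum-edgeWeight-νν : sum (map (edgeWeight ν ν) L) + ∑[ x < k ] ν x ≡ ∑[ x < k ] ν x * ∑[ x < k ] ν x
    sum-edgeWeight-νν =
      trans (cong (sum (map (edgeWeight ν ν) L) +_) (sum-cong-≗ {k} (λ x → sym ([1∸p]*[1∸p]≡1∸p (χ≤1 x)))))
                        (sum-edgeWeight ν ν loopless covers)

  ∑χ+∑ν : ∑[ x < k ] χ x + ∑[ x < k ] ν x ≡ k
  ∑χ+∑ν = trans (sym (∑-distrib-+ χ ν)) (trans (sum-cong-≗ {k} (λ x → m+[n∸m]≡n (χ≤1 x))) ∑-const-1)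

module Embedding {n m : ℕ} {S₁ : List (Sun n)} {S₂ : List (Sun m)}
  (system₁ : IsSunSystem n S₁) (system₂ : IsSunSystem m S₂)
  (ι : Fin n → Fin m) (ι-injective : Injective _≡_ _≡_ ι)
  (embed : ∀ s → s ∈ S₁ → Σ (Sun m) λ t → t ∈ S₂ × SameSubgraph (mapSun ι ι-injective s) t) where

  open ImageIndicator ι ι-injective
  open OldNewLabelling χ χ≤1

  ιₑ : Edge n → Edge m
  ιₑ = Product.map ι ι

  sunEdges-mapSun : ∀ s → sunEdges (mapSun ι ι-injective s) ≡ map ιₑ (sunEdges s)
  sunEdges-mapSun (sun (a ∷ b ∷ c ∷ d ∷ e ∷ f ∷ []) _) = refl

  HasEdge-mapSun⁺ : ∀ s {i j} → HasEdge s i j → HasEdge (mapSun ι ι-injective s) (ι i) (ι j)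
  HasEdge-mapSun⁺ s (e , e∈ , same) =
    ιₑ e , subst (ιₑ e ∈_) (sym (sunEdges-mapSun s)) (∈-map⁺ ιₑ e∈) ,
    Sum.map (Product.map (cong ι) (cong ι)) (Product.map (cong ι) (cong ι)) same

  HasEdge-mapSun⁻ : ∀ s {x y} → HasEdge (mapSun ι ι-injective s) x y → BothOld (x , y)
  HasEdge-mapSun⁻ s (e , e∈ , same) with ∈-map⁻ ιₑ (subst (e ∈_) (sunEdges-mapSun s) e∈)
  ... | (i , j) , _ , refl with same
  ...   | inj₁ (refl , refl) = χ-image i , χ-image j
  ...   | inj₂ (refl , refl) = χ-image j , χ-image i

  -- An old edge of a sun of S₂ lies in the image of a sun of S₁, and by
  -- uniqueness of edge covers that image is the whole sun.
  oldEdge⇒oldSun : ∀ {t p q} → t ∈ S₂ → (p , q) ∈ sunEdges t → BothOld (p , q) → All BothOld (sunEdges t)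
  oldEdge⇒oldSun {t} t∈ pq∈ (χp≡1 , χq≡1)
    with ιi≢ιj ← All.lookup (sunEdges-loopless t) pq∈
    with i , refl ← χ-pos (≤-reflexive (sym χp≡1))
    with j , refl ← χ-pos (≤-reflexive (sym χq≡1))
    with s , s∈ , s∋ij ← sunSystem-covers system₁ (ιi≢ιj ∘ cong ι)
    with t′ , t′∈ , same ← embed s s∈
    with refl ← sunSystem-unique system₂ ιi≢ιj t∈ t′∈ (_ , pq∈ , inj₁ (refl , refl))
                  (Equivalence.to (same (ι i) (ι j)) (HasEdge-mapSun⁺ s s∋ij))
    = tabulate λ {e} e∈ →
        HasEdge-mapSun⁻ s (Equivalence.from (same (proj₁ e) (proj₂ e)) (e , e∈ , inj₁ (refl , refl)))

  sun-dichotomy : ∀ {t} → t ∈ S₂ → All BothOld (sunEdges t) ⊎ All (¬_ ∘ BothOld) (sunEdges t)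
  sun-dichotomy {t} t∈ with any? bothOld? (sunEdges t)
  ... | yes someOld = let _ , e∈ , old = find someOld in inj₁ (oldEdge⇒oldSun t∈ e∈ old)
  ... | no ¬someOld = inj₂ (¬Any⇒All¬ _ ¬someOld)

  private
    L₂ : List (Edge m)
    L₂ = concatMap sunEdges S₂

  n+∑ν≡m : n + ∑[ x < m ] ν x ≡ m
  n+∑ν≡m = trans (cong (_+ ∑[ x < m ] ν x) (sym ∑-χ)) ∑χ+∑ν

  sum-mixed≡n*∑ν : sum (map (edgeWeight χ ν) L₂) ≡ n * ∑[ x < m ] ν x
  sum-mixed≡n*∑ν = trans (sum-edgeWeight-χν (sunSystem-loopless S₂) (sunSystem-coversOnce S₂ system₂))
                         (cong (_* ∑[ x < m ] ν x) ∑-χ)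

  sum-new+∑ν≡∑ν*∑ν : sum (map (edgeWeight ν ν) L₂) + ∑[ x < m ] ν x ≡ ∑[ x < m ] ν x * ∑[ x < m ] ν x
  sum-new+∑ν≡∑ν*∑ν = sum-edgeWeight-νν (sunSystem-loopless S₂) (sunSystem-coversOnce S₂ system₂)

  2*sum-mixed≤5*sum-new : 2 * sum (map (edgeWeight χ ν) L₂) ≤ 5 * sum (map (edgeWeight ν ν) L₂)
  2*sum-mixed≤5*sum-new =
    subst₂ (λ C W → 2 * C ≤ 5 * W)
      (sym (sum-map-concatMap (edgeWeight χ ν) sunEdges S₂))
      (sym (sum-map-concatMap (edgeWeight ν ν) sunEdges S₂))
      (sum-map-scaled-≤ 2 5 _ _ (tabulate λ t∈ → sun-bound _ (sun-dichotomy t∈)))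

extension-bound : ∀ {n m u C W} → n < m → n + u ≡ m → C ≡ n * u → W + u ≡ u * u → 2 * C ≤ 5 * W →
  7 * n + 5 ≤ 5 * m
extension-bound {n} {u = zero} n<m n+0≡m _ _ _ = ⊥-elim (<-irrefl (trans (sym (+-identityʳ n)) n+0≡m) n<m)
extension-bound {n} {m} {u@(suc _)} {W = W} _ n+u≡m refl W+u≡u*u 2C≤5W = begin
  7 * n + 5            ≡⟨ split-7 n ⟩
  5 * n + (2 * n + 5)  ≤⟨ +-monoʳ-≤ (5 * n) 2n+5≤5u ⟩
  5 * n + 5 * u        ≡⟨ *-distribˡ-+ 5 n u ⟨
  5 * (n + u)          ≡⟨ cong (5 *_) n+u≡m ⟩
  5 * m                ∎
  where
  open ≤-Reasoning
  split-7 : ∀ n → 7 * n + 5 ≡ 5 * n + (2 * n + 5)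
  split-7 = solve-∀
  2n+5≤5u : 2 * n + 5 ≤ 5 * u
  2n+5≤5u = *-cancelʳ-≤ (2 * n + 5) (5 * u) u (begin
    (2 * n + 5) * u      ≡⟨ *-distribʳ-+ u (2 * n) 5 ⟩
    2 * n * u + 5 * u    ≡⟨ cong (_+ 5 * u) (*-assoc 2 n u) ⟩
    2 * (n * u) + 5 * u  ≤⟨ +-monoˡ-≤ (5 * u) 2C≤5W ⟩
    5 * W + 5 * u        ≡⟨ *-distribˡ-+ 5 W u ⟨
    5 * (W + u)          ≡⟨ cong (5 *_) W+u≡u*u ⟩
    5 * (u * u)          ≡⟨ *-assoc 5 u u ⟨
    5 * u * u            ∎)

lemma3p1 : (n m : ℕ) (S₁ : List (Sun n)) (S₂ : List (Sun m)) →
    IsSunSystem n S₁ → IsSunSystem m S₂ → EmbeddedIn S₁ S₂ → n < m →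
    7 * n + 5 ≤ 5 * m
lemma3p1 n m S₁ S₂ system₁ system₂ (ι , ι-injective , embed) n<m =
  extension-bound n<m n+∑ν≡m sum-mixed≡n*∑ν sum-new+∑ν≡∑ν*∑ν 2*sum-mixed≤5*sum-new
  where open Embedding system₁ system₂ ι ι-injective embed
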